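{- Let $D=(b_1,\dots,b_N)$ be a general Dyck path and $R^{(0)}$ a weakly increasing rank sequence such that $T(D,R^{(0)})$ is a positive path diagram, and run Algorithm VIB from $T(D,R^{(0)})$. If at some stage a row count $c(k)$ becomes $\ge0$, then $c(k)$ never becomes negative at any later stage. In particular, letting $U$ be the maximum of the set $\{r_i^{(0)}+b_i: b_i>0\}\cup\{r_j^{(0)}: b_j<0\}$, every path diagram produced by the algorithm satisfies $c(k)\ge0$ for all $k>U$.
   Context: A path diagram $T(D,R)$, $R=(r_1,\dots,r_N)$, consists of arrows $A_i=(1,b_i)$ starting at $(i,r_i)$ with end rank $r_i+b_i$. Red arrow: $b_i>0$, segment in row $j$ (strip between heights $j,j+1$) iff $r_i\le j\le r_i+b_i-1$; blue: $b_i<0$, segment in row $j$ iff $r_i+b_i\le j\le r_i-1$. Row count $c(j)$ = #red minus #blue segments in row $j$; balanced: all $c(j)=0$. $T$ is increasing if $R$ is weakly increasing, and positive if it is increasing and all end ranks are $\ge0$. A general Dyck path has sum $0$ and nonnegative partial sums $b_1+\dots+b_{i-1}$. Algorithm VIB: starting from $T(D,R^{(0)})$, repeat: if all row counts are $\le0$, stop; otherwise find the lowest row $j$ with $c(j)>0$, find the rightmost arrow starting at level $j$, say $A_i$, and increase $r_i$ by $1$. -}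

module Defs where

open import Data.Nat using (ℕ; zero; suc)
open import Data.Fin using (Fin; zero; suc; toℕ) renaming (_≤_ to _≤ᶠ_)
import Data.Fin as Fin
import Data.Nat as Nat
open import Data.Integer using (ℤ; _+_; _-_; _≤_; _<_; _≤?_; _<?_; 0ℤ; 1ℤ; -1ℤ)
open import Data.Bool using (Bool; true; false; if_then_else_; _∧_)
open import Relation.Nullary using (does; ¬_)
open import Relation.Binary.PropositionalEquality using (_≡_)
open import Data.Product using (Σ; _×_; ∃)
open import Data.Sum using (_⊎_)
open import Relation.Binary.Construct.Closure.ReflexiveTransitive using (Star)

-- A sequence of N integers (step sequence D or rank sequence R), indexed by Fin N
Seq : ℕ → Set
Seq N = Fin N → ℤ

sumFin : ∀ {n} → (Fin n → ℤ) → ℤ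
sumFin {zero}  f = 0ℤ
sumFin {suc n} f = f zero + sumFin (λ i → f (suc i))

prefixSum : ∀ {N} → Seq N → ℕ → ℤ
prefixSum b m = sumFin (λ k → if does (toℕ k Nat.<? m) then b k else 0ℤ)

-- general Dyck path: total sum 0 and nonnegative partial sums b_1+...+b_{i-1}
-- (i = 1..N, i.e. m = i-1 ranges over 0..N-1); steps are nonzero (each arrow red or blue)
IsGeneralDyck : ∀ {N} → Seq N → Set
IsGeneralDyck {N} b =
  (sumFin b ≡ 0ℤ) × (∀ (i : Fin N) → 0ℤ ≤ prefixSum b (toℕ i)) × (∀ i → ¬ (b i ≡ 0ℤ))

-- contribution of arrow with slope b, starting rank r, to row j (strip between j and j+1)
segment : ℤ → ℤ → ℤ → ℤ
segment b r j =
  if does (0ℤ <? b) then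
    (if does (r ≤? j) ∧ does (j ≤? (r + b) - 1ℤ) then 1ℤ else 0ℤ)
  else if does (b <? 0ℤ) then
    (if does ((r + b) ≤? j) ∧ does (j ≤? r - 1ℤ) then -1ℤ else 0ℤ)
  else 0ℤ

-- row count c(j) of T(D,R): #red minus #blue segments in row j
rowCount : ∀ {N} → Seq N → Seq N → ℤ → ℤ
rowCount b r j = sumFin (λ i → segment (b i) (r i) j)

IsIncreasing : ∀ {N} → Seq N → Set
IsIncreasing {N} r = ∀ (i i' : Fin N) → i ≤ᶠ i' → r i ≤ r i'

IsPositive : ∀ {N} → Seq N → Seq N → Set
IsPositive b r = IsIncreasing r × (∀ i → 0ℤ ≤ r i + b i)

bump : ∀ {N} → Seq N → Fin N → Seq N
bump r i i' = if does (i' Fin.≟ i) then r i' + 1ℤ else r i'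

-- One step of Algorithm VIB from R to R': not all row counts are ≤ 0,
-- j is the lowest row with c(j) > 0, A_i is the rightmost arrow starting at level j,
-- and R' is R with r_i increased by 1.
VIBStep : ∀ {N} → Seq N → Seq N → Seq N → Set
VIBStep {N} b r r' =
  Σ ℤ λ j → Σ (Fin N) λ i →
    (0ℤ < rowCount b r j) × (∀ j' → j' < j → rowCount b r j' ≤ 0ℤ)
    × (r i ≡ j) × (∀ i' → r i' ≡ j → i' ≤ᶠ i)
    × (∀ i' → r' i' ≡ bump r i i')

VIBSteps : ∀ {N} → Seq N → Seq N → Seq N → Set
VIBSteps b = Star (VIBStep b)

IsMaxU : ∀ {N} → Seq N → Seq N → ℤ → Set
IsMaxU b r U =
  (∀ i → 0ℤ < b i → r i + b i ≤ U) × (∀ i → b i < 0ℤ → r i ≤ U)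
  × ∃ (λ i → ((0ℤ < b i) × (r i + b i ≡ U)) ⊎ ((b i < 0ℤ) × (r i ≡ U)))

-- Moving one arrow up by one level changes a row count only in its start
-- row, and there by at most 1.  The algorithm moves an arrow only when its
-- start row has a positive count, so a nonnegative count stays nonnegative.
-- Above U every blue arrow lies below the row, so the initial counts there
-- are nonnegative.

module Submission where

open import Defs
open import Data.Nat using (ℕ)
open import Data.Integer using (ℤ; _≤_; _<_; 0ℤ)
open import Data.Product using (_×_)

open import Data.Integer using (_+_; _-_; 1ℤ; -1ℤ; _≟_; _≤?_; _<?_; +≤+; -≤+)
open import Data.Integer.Properties
open import Data.Nat using (zero; suc; z≤n)
open import Data.Fin using (Fin; zero; suc)
import Data.Fin as Fin
open import Data.Fin.Properties using (suc-injective)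
open import Function using (_∘_)
open import Data.Bool using (Bool; true; false; if_then_else_; _∧_)
open import Data.Product using (_,_)
open import Data.Empty using (⊥-elim)
open import Relation.Nullary using (does; yes; no)
open import Relation.Binary.PropositionalEquality
open import Relation.Binary.Construct.Closure.ReflexiveTransitive using (ε; _◅_)

sumFin-cong : ∀ {n} {f g : Fin n → ℤ} → (∀ i → f i ≡ g i) → sumFin f ≡ sumFin g
sumFin-cong {zero}  f≡g = refl
sumFin-cong {suc n} f≡g = cong₂ _+_ (f≡g zero) (sumFin-cong (λ i → f≡g (suc i)))

sumFin-mono : ∀ {n} {f g : Fin n → ℤ} → (∀ i → f i ≤ g i) → sumFin f ≤ sumFin g
sumFin-mono {zero}  f≤g = ≤-refl
sumFin-mono {suc n} f≤g = +-mono-≤ (f≤g zero) (sumFin-mono (λ i → f≤g (suc i)))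

sumFin-nonneg : ∀ {n} {f : Fin n → ℤ} → (∀ i → 0ℤ ≤ f i) → 0ℤ ≤ sumFin f
sumFin-nonneg {zero}  f≥0 = ≤-refl
sumFin-nonneg {suc n} f≥0 = +-mono-≤ (f≥0 zero) (sumFin-nonneg (λ i → f≥0 (suc i)))

sumFin-mono-except : ∀ {n} {f g : Fin n → ℤ} (i : Fin n) (d : ℤ) →
  (∀ i' → i' ≢ i → f i' ≤ g i') → f i ≤ g i + d → sumFin f ≤ sumFin g + d
sumFin-mono-except {suc n} {f} {g} zero d f≤g fi≤gi+d = begin
  f zero + sumFin (λ i → f (suc i))  ≤⟨ +-mono-≤ fi≤gi+d (sumFin-mono (λ i → f≤g (suc i) λ ())) ⟩
  g zero + d + S                     ≡⟨ +-assoc (g zero) d S ⟩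
  g zero + (d + S)                   ≡⟨ cong (g zero +_) (+-comm d S) ⟩
  g zero + (S + d)                   ≡⟨ +-assoc (g zero) S d ⟨
  g zero + S + d                     ∎
  where
  open ≤-Reasoning
  S = sumFin (λ i → g (suc i))
sumFin-mono-except {suc n} {f} {g} (suc i) d f≤g fi≤gi+d = begin
  f zero + sumFin (λ i → f (suc i))  ≤⟨ +-mono-≤ (f≤g zero λ ())
                                          (sumFin-mono-except i d
                                            (λ i' i'≢i → f≤g (suc i') (i'≢i ∘ suc-injective))
                                            fi≤gi+d) ⟩
  g zero + (S + d)                   ≡⟨ +-assoc (g zero) S d ⟨
  g zero + S + d                     ∎
  where
  open ≤-Reasoning
  S = sumFin (λ i → g (suc i))

indicator-nonneg : ∀ (x : Bool) → 0ℤ ≤ (if x then 1ℤ else 0ℤ)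
indicator-nonneg true  = +≤+ z≤n
indicator-nonneg false = ≤-refl

indicator-≤1 : ∀ (x : Bool) → (if x then 1ℤ else 0ℤ) ≤ 1ℤ
indicator-≤1 true  = ≤-refl
indicator-≤1 false = +≤+ z≤n

negIndicator-nonpos : ∀ (x : Bool) → (if x then -1ℤ else 0ℤ) ≤ 0ℤ
negIndicator-nonpos true  = -≤+
negIndicator-nonpos false = ≤-refl

negIndicator-≥-1 : ∀ (x : Bool) → -1ℤ ≤ (if x then -1ℤ else 0ℤ)
negIndicator-≥-1 true  = ≤-refl
negIndicator-≥-1 false = -≤+

+1-1 : ∀ x → x + 1ℤ - 1ℤ ≡ x
+1-1 x = trans (+-assoc x 1ℤ -1ℤ) (+-identityʳ x)

segment-bump-mono : ∀ b r k → k ≢ r → segment b r k ≤ segment b (r + 1ℤ) k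
segment-bump-mono b r k k≢r with 0ℤ <? b
... | yes _ with r ≤? k | k ≤? r + b - 1ℤ
...   | no _  | _     = indicator-nonneg _
...   | yes _ | no _  = indicator-nonneg _
...   | yes r≤k | yes k≤top with r + 1ℤ ≤? k | k ≤? r + 1ℤ + b - 1ℤ
...     | yes _ | yes _ = ≤-refl
...     | no r+1≰k | _  = ⊥-elim (r+1≰k (subst (_≤ k) (+-comm 1ℤ r)
                            (i<j⇒suc[i]≤j (≤∧≢⇒< r≤k (k≢r ∘ sym)))))
...     | yes _ | no k≰top = ⊥-elim (k≰top (≤-trans k≤top
                            (+-monoˡ-≤ -1ℤ (+-monoˡ-≤ b (i≤i+j r 1ℤ)))))
segment-bump-mono b r k k≢r | no _ with b <? 0ℤ
... | no _ = ≤-refl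
... | yes _ with r + 1ℤ + b ≤? k | k ≤? r + 1ℤ - 1ℤ
...   | no _  | _    = negIndicator-nonpos _
...   | yes _ | no _ = negIndicator-nonpos _
...   | yes bot≤k | yes k≤r with r + b ≤? k | k ≤? r - 1ℤ
...     | yes _ | yes _ = ≤-refl
...     | no bot≰k | _  = ⊥-elim (bot≰k (≤-trans (+-monoˡ-≤ b (i≤i+j r 1ℤ)) bot≤k))
...     | yes _ | no k≰r-1 = ⊥-elim (k≰r-1 (subst (k ≤_) (+-comm -1ℤ r)
                            (i<j⇒i≤pred[j] (≤∧≢⇒< (subst (k ≤_) (+1-1 r) k≤r) k≢r))))

segment-bump-≥-1 : ∀ b r k → segment b r k ≤ segment b (r + 1ℤ) k + 1ℤ
segment-bump-≥-1 b r k with 0ℤ <? b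
... | yes _ = ≤-trans (indicator-≤1 _) (+-monoˡ-≤ 1ℤ (indicator-nonneg
                (does (r + 1ℤ ≤? k) ∧ does (k ≤? r + 1ℤ + b - 1ℤ))))
... | no _ with b <? 0ℤ
...   | no _  = +≤+ z≤n
...   | yes _ = ≤-trans (negIndicator-nonpos _) (+-monoˡ-≤ 1ℤ (negIndicator-≥-1
                (does (r + 1ℤ + b ≤? k) ∧ does (k ≤? r + 1ℤ - 1ℤ))))

segment-nonneg : ∀ b r k → (b < 0ℤ → r < k) → 0ℤ ≤ segment b r k
segment-nonneg b r k blue⇒r<k with 0ℤ <? b
... | yes _ = indicator-nonneg _
... | no _ with b <? 0ℤ
...   | no _ = ≤-refl
...   | yes b<0 with r + b ≤? k | k ≤? r - 1ℤ
...     | no _  | _    = ≤-refl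
...     | yes _ | no _ = ≤-refl
...     | yes _ | yes k≤r-1 = ⊥-elim (<-asym (blue⇒r<k b<0)
                            (i≤pred[j]⇒i<j (subst (k ≤_) (+-comm r -1ℤ) k≤r-1)))

0<x+1⇒0≤x : ∀ x → 0ℤ < x + 1ℤ → 0ℤ ≤ x
0<x+1⇒0≤x x 0<x+1 =
  subst (0ℤ ≤_) (trans (+-comm -1ℤ (x + 1ℤ)) (+1-1 x)) (i<j⇒i≤pred[j] 0<x+1)

bump-self : ∀ {N} (r : Seq N) i → bump r i i ≡ r i + 1ℤ
bump-self r i with i Fin.≟ i
... | yes _   = refl
... | no i≢i = ⊥-elim (i≢i refl)

bump-other : ∀ {N} (r : Seq N) {i i'} → i' ≢ i → bump r i i' ≡ r i'
bump-other r {i} {i'} i'≢i with i' Fin.≟ i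
... | yes i'≡i = ⊥-elim (i'≢i i'≡i)
... | no _     = refl

segment-bump-other : ∀ {N} (b r : Seq N) {i i'} k → i' ≢ i →
  segment (b i') (r i') k ≤ segment (b i') (bump r i i') k
segment-bump-other b r {i' = i'} k i'≢i = ≤-reflexive (cong (λ s → segment (b i') s k) (sym (bump-other r i'≢i)))

rowCount-bump-mono : ∀ {N} (b r : Seq N) i k → k ≢ r i →
  rowCount b r k ≤ rowCount b (bump r i) k
rowCount-bump-mono b r i k k≢ri = sumFin-mono segment-bump
  where
  segment-bump : ∀ i' → segment (b i') (r i') k ≤ segment (b i') (bump r i i') k
  segment-bump i' with i' Fin.≟ i
  ... | yes refl = segment-bump-mono (b i) (r i) k k≢ri
  ... | no _     = ≤-refl

rowCount-bump-≥-1 : ∀ {N} (b r : Seq N) i k →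
  rowCount b r k ≤ rowCount b (bump r i) k + 1ℤ
rowCount-bump-≥-1 b r i k = sumFin-mono-except i 1ℤ
  (λ i' → segment-bump-other b r k)
  (subst (λ s → segment (b i) (r i) k ≤ segment (b i) s k + 1ℤ) (sym (bump-self r i))
    (segment-bump-≥-1 (b i) (r i) k))

rowCount-cong : ∀ {N} (b : Seq N) {r r'} k → (∀ i → r i ≡ r' i) →
  rowCount b r k ≡ rowCount b r' k
rowCount-cong b k r≗r' = sumFin-cong (λ i → cong (λ s → segment (b i) s k) (r≗r' i))

VIBStep-preserves-nonneg : ∀ {N} (b : Seq N) {r r'} k → VIBStep b r r' →
  0ℤ ≤ rowCount b r k → 0ℤ ≤ rowCount b r' k
VIBStep-preserves-nonneg b {r} {r'} k (j , i , 0<cj , _ , ri≡j , _ , r'≗bump) 0≤ck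
  rewrite rowCount-cong b k r'≗bump with k ≟ r i
... | no k≢ri  = ≤-trans 0≤ck (rowCount-bump-mono b r i k k≢ri)
... | yes k≡ri = 0<x+1⇒0≤x _ (<-≤-trans 0<ck (rowCount-bump-≥-1 b r i k))
  where
  0<ck : 0ℤ < rowCount b r k
  0<ck = subst (λ l → 0ℤ < rowCount b r l) (sym (trans k≡ri ri≡j)) 0<cj

VIBSteps-preserves-nonneg : ∀ {N} (b : Seq N) {r r'} k → VIBSteps b r r' →
  0ℤ ≤ rowCount b r k → 0ℤ ≤ rowCount b r' k
VIBSteps-preserves-nonneg b k ε         0≤ck = 0≤ck
VIBSteps-preserves-nonneg b k (s ◅ ss) 0≤ck =
  VIBSteps-preserves-nonneg b k ss (VIBStep-preserves-nonneg b k s 0≤ck)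

rowCount-nonneg-above-blue-starts : ∀ {N} (b r : Seq N) k →
  (∀ i → b i < 0ℤ → r i < k) → 0ℤ ≤ rowCount b r k
rowCount-nonneg-above-blue-starts b r k blue⇒r<k =
  sumFin-nonneg (λ i → segment-nonneg (b i) (r i) k (blue⇒r<k i))

lemma5 : ∀ {N : ℕ} (b r₀ : Seq N) → IsGeneralDyck b → IsPositive b r₀ →
    (∀ (r r' : Seq N) (k : ℤ) → VIBSteps b r₀ r → VIBSteps b r r' →
      0ℤ ≤ rowCount b r k → 0ℤ ≤ rowCount b r' k)
    × (∀ (U : ℤ) → IsMaxU b r₀ U → ∀ (r : Seq N) (k : ℤ) → VIBSteps b r₀ r →
      U < k → 0ℤ ≤ rowCount b r k)
lemma5 b r₀ _ _ =
  (λ r r' k _ → VIBSteps-preserves-nonneg b k) ,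
  (λ U (_ , blue≤U , _) r k steps U<k →
    VIBSteps-preserves-nonneg b k steps
      (rowCount-nonneg-above-blue-starts b r₀ k (λ i bi<0 → ≤-<-trans (blue≤U i bi<0) U<k)))
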